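{- Let $N<M$ be natural numbers and let $[N,M)=\{N,N+1,\ldots,M-1\}$. Suppose $\emptyset\neq A_1\subseteq{}^N2$, $\emptyset\neq A_2\subseteq{}^{[N,M)}2$ and $A\subseteq{}^M2$ are such that $\|A_1\|_4^N>1$, $\|A_2\|_4^{[N,M)}>1$ and $A=\{f\cup g: f\in A_1,\ g\in A_2\}$. Then $\|A\|_4^M\geq\min\{\|A_1\|_4^N,\|A_2\|_4^{[N,M)}\}$.
   Context: For a finite set $I$ (here $I=N=\{0,\ldots,N-1\}$, $I=M$, or $I=[N,M)$): ${}^I2$ is the set of functions $I\to\{0,1\}$ and ${}^{\underline I}2$ is the set of partial functions $\sigma$ with $\mathrm{dom}(\sigma)\subseteq I$ and values in $\{0,1\}$ (including the empty function); functions are sets of ordered pairs. For $\sigma\in{}^{\underline I}2$, $[\sigma]=\{f\in{}^I2:\sigma\subseteq f\}$. For $A\subseteq{}^I2$, $\Delta_I(A)=\{\sigma\in{}^{\underline I}2:[\sigma]\cap A=\emptyset\text{ and }[\rho]\cap A\neq\emptyset\text{ for all }\rho\subsetneq\sigma\}$. For $\delta_1,\delta_2\subseteq{}^{\underline I}2$, $\delta_1\preceq\delta_2$ iff every $\sigma\in\delta_1$ has some $\rho\in\delta_2$ with $\rho\subseteq\sigma$. For $\delta\subseteq{}^{\underline I}2$, $\mathrm{hn}(\delta)$ is the maximum of $k+1$ over natural numbers $k<|I|$ such that for every $\delta'\subseteq\delta$ there is $\delta''\subseteq\delta'$ whose elements have pairwise disjoint domains and $|\bigcup_{\sigma\in\delta''}\mathrm{dom}(\sigma)|\geq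 k|\delta'|$; $\mathrm{HN}(\delta)=\max\{\mathrm{hn}(\delta'):\delta'\subseteq{}^{\underline I}2,\ \delta\preceq\delta'\}$; and $\|A\|_4^I=\mathrm{HN}(\Delta_I(A))$ for $A\subseteq{}^I2$. -}

module Defs where

open import Data.Nat using (ℕ; zero; suc; _+_; _*_; _≤_; _<_)
open import Data.Bool using (Bool; true; false; T; _∨_)
open import Data.Maybe using (Maybe; just; nothing; is-just)
open import Data.Fin using (Fin)
open import Data.Vec using (Vec; lookup)
open import Data.List using (List; length; filter)
open import Data.Bool.ListAction using (any)
import Data.Bool.Properties
open import Data.List.Relation.Unary.All using (All)
open import Data.List.Relation.Unary.Unique.Propositional using (Unique)
open import Data.List.Relation.Unary.AllPairs using (AllPairs)
open import Data.List.Membership.Propositional using (_∈_)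
open import Data.Product using (Σ; ∃; _×_; _,_)
open import Data.Empty using (⊥)
open import Relation.Binary.PropositionalEquality using (_≡_; _≢_)
open import Relation.Nullary using (¬_)
open import Relation.Unary using (Pred)
open import Data.List using (allFin)

-- An index set I of size n is identified with {0,…,n-1} (for I = [N,M)
-- via the shift i ↦ i - N).  Total functions I → 2:
Fun : ℕ → Set
Fun n = Vec Bool n

-- Partial functions I ⇀ 2 (nothing = undefined at that point).
PFun : ℕ → Set
PFun n = Vec (Maybe Bool) n

_⊆ᶠ_ : ∀ {n} → PFun n → Fun n → Set
_⊆ᶠ_ {n} σ f = ∀ (i : Fin n) (b : Bool) → lookup σ i ≡ just b → lookup f i ≡ b

_⊆ᵖ_ : ∀ {n} → PFun n → PFun n → Set
_⊆ᵖ_ {n} ρ σ = ∀ (i : Fin n) (b : Bool) → lookup ρ i ≡ just b → lookup σ i ≡ just b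

_⊊ᵖ_ : ∀ {n} → PFun n → PFun n → Set
ρ ⊊ᵖ σ = ρ ⊆ᵖ σ × ρ ≢ σ

-- A subset A ⊆ ᴵ2 is given by its (decidable) characteristic function.
-- [σ] ∩ A ≠ ∅
Meets : ∀ {n} → PFun n → (Fun n → Bool) → Set
Meets {n} σ A = ∃ λ (f : Fun n) → σ ⊆ᶠ f × T (A f)

Δ : ∀ {n} → (Fun n → Bool) → Pred (PFun n) _
Δ A σ = ¬ Meets σ A × (∀ ρ → ρ ⊊ᵖ σ → Meets ρ A)

_⪯_ : ∀ {n} → Pred (PFun n) _ → Pred (PFun n) _ → Set
_⪯_ {n} δ₁ δ₂ = ∀ (σ : PFun n) → δ₁ σ → ∃ λ ρ → δ₂ ρ × ρ ⊆ᵖ σ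

DisjointDom : ∀ {n} → PFun n → PFun n → Set
DisjointDom {n} σ ρ = ∀ (i : Fin n) → T (is-just (lookup σ i)) → T (is-just (lookup ρ i)) → ⊥

unionDomSize : ∀ {n} → List (PFun n) → ℕ
unionDomSize {n} δ =
  length (filter (λ i → Data.Bool.Properties._≟_ (any (λ σ → is-just (lookup σ i)) δ) true) (allFin n))

-- Finite subsets of ᴵ̲2 are represented by duplicate-free lists.
HnProp : ∀ {n} → Pred (PFun n) _ → ℕ → Set
HnProp {n} δ k =
  ∀ (δ' : List (PFun n)) → Unique δ' → All δ δ' →
    ∃ λ (δ'' : List (PFun n)) → Unique δ'' × All (_∈ δ') δ'' ×
      AllPairs DisjointDom δ'' × k * length δ' ≤ unionDomSize δ''

IsMax : (ℕ → Set) → ℕ → Set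
IsMax S v = S v × (∀ w → S w → w ≤ v)

IsHn : ∀ {n} → Pred (PFun n) _ → ℕ → Set
IsHn {n} δ = IsMax (λ v → ∃ λ k → k < n × v ≡ suc k × HnProp δ k)

IsHN : ∀ {n} → Pred (PFun n) _ → ℕ → Set
IsHN {n} δ = IsMax (λ v → ∃ λ (δ' : PFun n → Bool) →
  δ ⪯ (λ σ → T (δ' σ)) × IsHn (λ σ → T (δ' σ)) v)

IsNorm4 : ∀ {n} → (Fun n → Bool) → ℕ → Set
IsNorm4 A = IsHN (Δ A)

-- Choose covers d₁ of Δ(A₁) and d₂ of Δ(A₂) realising ‖A₁‖₄ = k₁ + 1 and ‖A₂‖₄ = k₂ + 1.
-- If a ∪ b is a minimal partial function missing A = A₁ × A₂, then either a is minimal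
-- missing A₁, or b ≠ ∅, in which case a meets A₁ and b is minimal missing A₂. Hence
-- d = {a ∪ ∅ : a ∈ d₁} ∪ {∅ ∪ b : b ∈ d₂} covers Δ(A). A finite subfamily of d splits
-- into a d₁-part and a d₂-part whose hn-witnesses live on the disjoint index sets [0, N)
-- and [N, M), so together they witness hn for d with the factor min(k₁, k₂); since
-- k₁ ≥ 1 forces ∅ ∉ d₁, the two parts never share an element. Therefore
-- ‖A‖₄ ≥ hn(d) > min(k₁, k₂).

module Submission where

open import Defs
open import Data.Nat using (ℕ; _+_; _<_; _≤_; _⊓_)
open import Data.Bool using (Bool; T)
open import Data.Vec using (Vec; _++_)
open import Data.Product using (∃; ∃₂; _×_)
open import Function.Bundles using (_⇔_)
open import Relation.Binary.PropositionalEquality using (_≡_)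

open import Data.Nat using (zero; suc; _*_; s≤s; _<?_)
open import Data.Nat.Properties
  using (≤-trans; ≤-reflexive; +-identityʳ; +-suc; +-mono-≤; +-monoˡ-≤; *-monoˡ-≤; *-distribˡ-+;
         *-identityʳ; m≤n+m; m⊓n≤m; m⊓n≤n; <⇒≱; ≰⇒>; _≤?_; module ≤-Reasoning)
open import Data.Bool using (true; false; _∧_; _∨_)
open import Data.Bool.Properties using (T-∧; T-∨; ∨-assoc; ∨-identityʳ) renaming (_≟_ to _≟ᵇ_)
open import Data.Bool.ListAction using (any; or)
open import Data.Maybe using (Maybe; just; nothing; is-just)
import Data.Maybe.Properties as Maybe
open import Data.Fin using (Fin; _↑ˡ_; _↑ʳ_) renaming (zero to fzero; suc to fsuc)
open import Data.Vec using (lookup; replicate; take; drop; splitAt)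
open import Data.Vec.Properties using (≡-dec; ++-injectiveˡ; ++-injectiveʳ; take++drop≡id;
  lookup-++ˡ; lookup-++ʳ; lookup-replicate)
import Data.Vec.Relation.Binary.Pointwise.Inductive as Pointwiseᵢ
import Data.Vec.Relation.Binary.Pointwise.Extensional as Pointwiseₑ
open import Data.List using (List; []; _∷_; length; map; filter; tabulate; allFin)
  renaming (_++_ to _++ₗ_)
open import Data.List.Properties using (length-++; length-map; map-∘; map-cong; map-tabulate;
  filter-++; filter-≐; filter-none)
open import Data.List.Relation.Unary.All as All using (All; []; _∷_)
import Data.List.Relation.Unary.All.Properties as All
open import Data.List.Relation.Unary.AllPairs as AllPairs using (AllPairs)
import Data.List.Relation.Unary.AllPairs.Properties as AllPairs
open import Data.List.Relation.Unary.Unique.Propositional using (Unique)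
import Data.List.Relation.Unary.Unique.Propositional.Properties as Unique
open import Data.List.Membership.Propositional using (_∈_)
open import Data.List.Membership.Propositional.Properties using (∈-map⁻)
open import Data.List.Relation.Unary.Any using (here; there)
import Data.List.Relation.Binary.Subset.Propositional.Properties as Subset
open import Data.List.Relation.Binary.Permutation.Propositional
  using (_↭_; ↭-refl; ↭-prep; ↭-sym; ↭-trans; ↭⇒↭ₛ)
open import Data.List.Relation.Binary.Permutation.Propositional.Properties using (shift; ↭-length)
import Data.List.Relation.Binary.Permutation.Setoid.Properties as Permutationₛ
open import Data.Product using (_,_; proj₁; proj₂)
open import Data.Sum using (_⊎_; inj₁; inj₂)
open import Data.Empty using (⊥; ⊥-elim)
open import Function using (_∘_; Equivalence)
open import Level using (Level; 0ℓ)
open import Relation.Binary.Core using (REL)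
open import Relation.Binary.PropositionalEquality
  using (refl; sym; trans; cong; cong₂; subst; setoid; module ≡-Reasoning)
open import Relation.Nullary using (¬_; Dec; yes; no; does)
open import Relation.Nullary.Decidable using (⌊_⌋; fromWitness; toWitness; decidable-stable)
open import Relation.Unary using (Pred; Decidable)

private
  variable
    a ℓ : Level
    A B C : Set a
    n N m : ℕ

Unique-resp-↭ : {xs ys : List A} → xs ↭ ys → Unique xs → Unique ys
Unique-resp-↭ {A = A} xs↭ys = Permutationₛ.Unique-resp-↭ (setoid A) (↭⇒↭ₛ xs↭ys)

Unique-++⁻ : (xs : List A) {ys : List A} → Unique (xs ++ₗ ys) → Unique xs × Unique ys
Unique-++⁻ []       ys!           = AllPairs.[] , ys!
Unique-++⁻ (x ∷ xs) (x∉ AllPairs.∷ xs++ys!) with Unique-++⁻ xs xs++ys!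
... | xs! , ys! = All.++⁻ˡ xs x∉ AllPairs.∷ xs! , ys!

Image : (A → C) → Pred A ℓ → Pred C _
Image f P y = ∃ λ x → P x × y ≡ f x

partitionImages : {P : Pred A ℓ} {Q : Pred B ℓ} (f : A → C) (g : B → C) {ys : List C} →
  All (λ y → Image f P y ⊎ Image g Q y) ys →
  ∃₂ λ xs zs → All P xs × All Q zs × ys ↭ map f xs ++ₗ map g zs
partitionImages f g [] = [] , [] , [] , [] , ↭-refl
partitionImages f g (inj₁ (x , px , refl) ∷ rest) with partitionImages f g rest
... | xs , zs , pxs , qzs , rest↭ = x ∷ xs , zs , px ∷ pxs , qzs , ↭-prep (f x) rest↭
partitionImages f g (inj₂ (z , qz , refl) ∷ rest) with partitionImages f g rest
... | xs , zs , pxs , qzs , rest↭ =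
  xs , z ∷ zs , pxs , qz ∷ qzs ,
  ↭-trans (↭-prep (g z) rest↭) (↭-sym (shift (g z) (map f xs) (map g zs)))

any-++-map : (p : C → Bool) (f : A → C) (g : B → C) (xs : List A) (ys : List B) →
  any p (map f xs ++ₗ map g ys) ≡ any (p ∘ f) xs ∨ any (p ∘ g) ys
any-++-map p f g []       ys = cong or (sym (map-∘ ys))
any-++-map p f g (x ∷ xs) ys =
  trans (cong (p (f x) ∨_) (any-++-map p f g xs ys)) (sym (∨-assoc (p (f x)) _ _))

any-cong : {p q : A → Bool} → (∀ x → p x ≡ q x) → (xs : List A) → any p xs ≡ any q xs
any-cong p≗q xs = cong or (map-cong p≗q xs)

any-false : (p : A → Bool) {xs : List A} → All (λ x → p x ≡ false) xs → any p xs ≡ false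
any-false p []             = refl
any-false p (px≡false ∷ e) rewrite px≡false = any-false p e

length-filter-map : {P : Pred B ℓ} (P? : Decidable P) (f : A → B) (xs : List A) →
  length (filter P? (map f xs)) ≡ length (filter (P? ∘ f) xs)
length-filter-map P? f []       = refl
length-filter-map P? f (x ∷ xs) with does (P? (f x))
... | true  = cong suc (length-filter-map P? f xs)
... | false = length-filter-map P? f xs

tabulate-+ : (f : Fin (N + m) → A) → tabulate f ≡ tabulate (f ∘ (_↑ˡ m)) ++ₗ tabulate (f ∘ (N ↑ʳ_))
tabulate-+ {N = zero}    f = refl
tabulate-+ {N = suc N}   f = cong (f fzero ∷_) (tabulate-+ {N = N} (f ∘ fsuc))

¬¬-maximum : {P : ℕ → Set} {n k : ℕ} → (∀ j → P j → j < n) → P k →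
  ¬ ¬ (∃ λ j → P j × ∀ j′ → P j′ → j′ ≤ j)
¬¬-maximum {P} {n} {k} P<n Pk noMaximum = descend n k Pk (m≤n+m n k)
  where
  descend : ∀ t j → P j → n ≤ j + t → ⊥
  descend zero    j Pj n≤j+0 = <⇒≱ (P<n j Pj) (subst (n ≤_) (+-identityʳ j) n≤j+0)
  descend (suc t) j Pj n≤j+1+t = noMaximum (j , Pj , below)
    where
    below : ∀ j′ → P j′ → j′ ≤ j
    below j′ Pj′ with j′ ≤? j
    ... | yes j′≤j = j′≤j
    ... | no j′≰j = ⊥-elim (descend t j′ Pj′
      (≤-trans n≤j+1+t (≤-trans (≤-reflexive (+-suc j t)) (+-monoˡ-≤ t (≰⇒> j′≰j)))))

countᶠ : (Fin n → Bool) → ℕ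
countᶠ p = length (filter (λ i → p i ≟ᵇ true) (allFin _))

countᶠ-cong : {p q : Fin n → Bool} → (∀ i → p i ≡ q i) → countᶠ p ≡ countᶠ q
countᶠ-cong {p = p} {q} p≗q =
  cong length (filter-≐ (λ i → p i ≟ᵇ true) (λ i → q i ≟ᵇ true)
    ((λ {i} e → trans (sym (p≗q i)) e) , (λ {i} e → trans (p≗q i) e)) (allFin _))

countᶠ-+ : (p : Fin (N + m) → Bool) → countᶠ p ≡ countᶠ (p ∘ (_↑ˡ m)) + countᶠ (p ∘ (N ↑ʳ_))
countᶠ-+ {N = N} {m = m} p = begin
  countᶠ p
    ≡⟨ cong (length ∘ filter P?) (tabulate-+ {N = N} (λ i → i)) ⟩
  length (filter P? (tabulate (_↑ˡ m) ++ₗ tabulate (N ↑ʳ_)))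
    ≡⟨ cong length (filter-++ P? (tabulate (_↑ˡ m)) _) ⟩
  length (filter P? (tabulate (_↑ˡ m)) ++ₗ filter P? (tabulate (N ↑ʳ_)))
    ≡⟨ length-++ (filter P? (tabulate (_↑ˡ m))) ⟩
  length (filter P? (tabulate (_↑ˡ m))) + length (filter P? (tabulate (N ↑ʳ_)))
    ≡⟨ cong₂ _+_ (countᶠ-tabulate (_↑ˡ m)) (countᶠ-tabulate (N ↑ʳ_)) ⟩
  countᶠ (p ∘ (_↑ˡ m)) + countᶠ (p ∘ (N ↑ʳ_)) ∎
  where
  open ≡-Reasoning
  P? : Decidable (λ i → p i ≡ true)
  P? i = p i ≟ᵇ true

  countᶠ-tabulate : (f : Fin n → Fin (N + m)) → length (filter P? (tabulate f)) ≡ countᶠ (p ∘ f)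
  countᶠ-tabulate f =
    trans (cong (length ∘ filter P?) (sym (map-tabulate (λ i → i) f)))
          (length-filter-map P? f (allFin _))

module _ (R : REL A B ℓ) where

  Lookupwise : Vec A n → Vec B n → Set ℓ
  Lookupwise xs ys = ∀ i → R (lookup xs i) (lookup ys i)

  private
    toInductive : {xs : Vec A n} {ys : Vec B n} → Lookupwise xs ys → Pointwiseᵢ.Pointwise R xs ys
    toInductive xs~ys = Pointwiseₑ.extensional⇒inductive (Pointwiseₑ.ext xs~ys)

    fromInductive : {xs : Vec A n} {ys : Vec B n} → Pointwiseᵢ.Pointwise R xs ys → Lookupwise xs ys
    fromInductive xs~ys = Pointwiseₑ.Pointwise.app (Pointwiseₑ.inductive⇒extensional xs~ys)

  Lookupwise-++⁺ : {ws : Vec A N} {xs : Vec B N} {ys : Vec A m} {zs : Vec B m} →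
    Lookupwise ws xs → Lookupwise ys zs → Lookupwise (ws ++ ys) (xs ++ zs)
  Lookupwise-++⁺ {ws = ws} {xs} {ys} {zs} ws~xs ys~zs =
    fromInductive {xs = ws ++ ys} {xs ++ zs}
      (Pointwiseᵢ.++⁺ (toInductive {xs = ws} {xs} ws~xs) (toInductive {xs = ys} {zs} ys~zs))

  Lookupwise-++⁻ : (ws : Vec A N) (xs : Vec B N) {ys : Vec A m} {zs : Vec B m} →
    Lookupwise (ws ++ ys) (xs ++ zs) → Lookupwise ws xs × Lookupwise ys zs
  Lookupwise-++⁻ ws xs {ys} {zs} w++y~x++z
    with Pointwiseᵢ.++⁻ ws xs (toInductive {xs = ws ++ ys} {xs ++ zs} w++y~x++z)
  ... | ws~xs , ys~zs = fromInductive ws~xs , fromInductive ys~zs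

  Lookupwise-replicateˡ : {x : A} {ys : Vec B n} → (∀ y → R x y) → Lookupwise (replicate n x) ys
  Lookupwise-replicateˡ {x = x} Rx i = subst (λ z → R z _) (sym (lookup-replicate i x)) (Rx _)

  Lookupwise-replicateʳ : {xs : Vec A n} {y : B} → (∀ x → R x y) → Lookupwise xs (replicate n y)
  Lookupwise-replicateʳ {y = y} Ry i = subst (R _) (sym (lookup-replicate i y)) (Ry _)

take-++ : (a : Vec A N) (b : Vec A m) → take N (a ++ b) ≡ a
take-++ {N = N} a b = ++-injectiveˡ _ a (take++drop≡id N (a ++ b))

drop-++ : (a : Vec A N) (b : Vec A m) → drop N (a ++ b) ≡ b
drop-++ {N = N} a b = ++-injectiveʳ _ a (take++drop≡id N (a ++ b))

⟦_⟧ : (PFun n → Bool) → Pred (PFun n) _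
⟦ d ⟧ σ = T (d σ)

-- σ ⊆ᶠ f, σ ⊆ᵖ ρ and DisjointDom σ ρ are, definitionally, Lookupwise _⊑ᶠ_ σ f,
-- Lookupwise _⊑ᵖ_ σ ρ and Lookupwise _#_ σ ρ.

_⊑ᶠ_ : Maybe Bool → Bool → Set
x ⊑ᶠ y = ∀ c → x ≡ just c → y ≡ c

_⊑ᵖ_ : Maybe Bool → Maybe Bool → Set
x ⊑ᵖ y = ∀ c → x ≡ just c → y ≡ just c

_#_ : Maybe Bool → Maybe Bool → Set
x # y = T (is-just x) → T (is-just y) → ⊥

_≟ᵖ_ : (σ ρ : PFun n) → Dec (σ ≡ ρ)
_≟ᵖ_ = ≡-dec (Maybe.≡-dec _≟ᵇ_)

∅ᵖ : PFun n
∅ᵖ = replicate _ nothing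

∅ᵖ-⊆ᶠ : (f : Fun n) → ∅ᵖ ⊆ᶠ f
∅ᵖ-⊆ᶠ f = Lookupwise-replicateˡ _⊑ᶠ_ {ys = f} (λ _ _ ())

∅ᵖ-⊆ᵖ : (σ : PFun n) → ∅ᵖ ⊆ᵖ σ
∅ᵖ-⊆ᵖ σ = Lookupwise-replicateˡ _⊑ᵖ_ {ys = σ} (λ _ _ ())

⊆ᵖ-refl : (σ : PFun n) → σ ⊆ᵖ σ
⊆ᵖ-refl σ i c σi≡c = σi≡c

∅ᵖ-disjointˡ : (σ : PFun n) → DisjointDom ∅ᵖ σ
∅ᵖ-disjointˡ σ = Lookupwise-replicateˡ _#_ {ys = σ} (λ _ ())

∅ᵖ-disjointʳ : (σ : PFun n) → DisjointDom σ ∅ᵖ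
∅ᵖ-disjointʳ σ = Lookupwise-replicateʳ _#_ {xs = σ} (λ _ _ ())

⊆ᶠ-++ : {a : PFun N} {b : PFun m} {f : Fun N} {g : Fun m} → a ⊆ᶠ f → b ⊆ᶠ g → (a ++ b) ⊆ᶠ (f ++ g)
⊆ᶠ-++ {a = a} {b} {f} {g} = Lookupwise-++⁺ _⊑ᶠ_ {ws = a} {f} {b} {g}

⊆ᶠ-++⁻ : (a : PFun N) (f : Fun N) {b : PFun m} {g : Fun m} → (a ++ b) ⊆ᶠ (f ++ g) → a ⊆ᶠ f × b ⊆ᶠ g
⊆ᶠ-++⁻ a f {b} {g} = Lookupwise-++⁻ _⊑ᶠ_ a f {b} {g}

⊆ᵖ-++ : {a a′ : PFun N} {b b′ : PFun m} → a ⊆ᵖ a′ → b ⊆ᵖ b′ → (a ++ b) ⊆ᵖ (a′ ++ b′)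
⊆ᵖ-++ {a = a} {a′} {b} {b′} = Lookupwise-++⁺ _⊑ᵖ_ {ws = a} {a′} {b} {b′}

DisjointDom-++ : {a a′ : PFun N} {b b′ : PFun m} →
  DisjointDom a a′ → DisjointDom b b′ → DisjointDom (a ++ b) (a′ ++ b′)
DisjointDom-++ {a = a} {a′} {b} {b′} = Lookupwise-++⁺ _#_ {ws = a} {a′} {b} {b′}

⊊ᵖ-++ˡ : {ρ a : PFun N} (b : PFun m) → ρ ⊊ᵖ a → (ρ ++ b) ⊊ᵖ (a ++ b)
⊊ᵖ-++ˡ {ρ = ρ} {a} b (ρ⊆a , ρ≢a) =
  ⊆ᵖ-++ {a = ρ} {a} {b} {b} ρ⊆a (⊆ᵖ-refl b) , ρ≢a ∘ ++-injectiveˡ ρ a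

⊊ᵖ-++ʳ : (a : PFun N) {ρ b : PFun m} → ρ ⊊ᵖ b → (a ++ ρ) ⊊ᵖ (a ++ b)
⊊ᵖ-++ʳ a {ρ} {b} (ρ⊆b , ρ≢b) =
  ⊆ᵖ-++ {a = a} {a} {ρ} {b} (⊆ᵖ-refl a) ρ⊆b , ρ≢b ∘ ++-injectiveʳ a a

covered : List (PFun n) → Fin n → Bool
covered δ i = any (λ σ → is-just (lookup σ i)) δ

unionDomSize-∅ᵖ : {δ : List (PFun n)} → All (_≡ ∅ᵖ) δ → unionDomSize δ ≡ 0
unionDomSize-∅ᵖ {n = n} {δ = δ} δ≡∅ = begin
  countᶠ (covered δ)
    ≡⟨ countᶠ-cong {n = n} (λ i → any-false (λ σ → is-just (lookup σ i))
         (All.map (λ { refl → cong is-just (lookup-replicate i nothing) }) δ≡∅)) ⟩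
  countᶠ {n} (λ _ → false)
    ≡⟨ cong length (filter-none (λ _ → false ≟ᵇ true) (All.universal (λ _ ()) (allFin n))) ⟩
  0 ∎
  where open ≡-Reasoning

HnProp⇒∅ᵖ∉ : {d : PFun n → Bool} {k : ℕ} → 1 ≤ k → HnProp ⟦ d ⟧ k → ¬ T (d ∅ᵖ)
HnProp⇒∅ᵖ∉ {k = k} 1≤k hn d∅ with hn (∅ᵖ ∷ []) (All.[] AllPairs.∷ AllPairs.[]) (d∅ ∷ [])
... | δ , _ , δ⊆[∅ᵖ] , _ , k*1≤|δ| with ≤-trans 1≤k (begin
  k                ≡⟨ sym (*-identityʳ k) ⟩
  k * 1            ≤⟨ k*1≤|δ| ⟩
  unionDomSize δ   ≡⟨ unionDomSize-∅ᵖ (All.map (λ { (here σ≡∅) → σ≡∅ ; (there ()) }) δ⊆[∅ᵖ]) ⟩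
  0                ∎)
  where open ≤-Reasoning
... | ()

module Juxtaposition (N m : ℕ) where

  padʳ : PFun N → PFun (N + m)
  padʳ a = a ++ ∅ᵖ

  padˡ : PFun m → PFun (N + m)
  padˡ b = ∅ᵖ ++ b

  isEmpty : PFun n → Bool
  isEmpty σ = ⌊ σ ≟ᵖ ∅ᵖ ⌋

  isEmpty⇒≡∅ᵖ : (σ : PFun n) → T (isEmpty σ) → σ ≡ ∅ᵖ
  isEmpty⇒≡∅ᵖ σ = toWitness {a? = σ ≟ᵖ ∅ᵖ}

  isEmpty-∅ᵖ : T (isEmpty (∅ᵖ {n}))
  isEmpty-∅ᵖ = fromWitness {a? = ∅ᵖ ≟ᵖ ∅ᵖ} refl

  -- {a ∪ ∅ : a ∈ d₁} ∪ {∅ ∪ b : b ∈ d₂}, recognised by splitting σ at N.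
  _⊕_ : (PFun N → Bool) → (PFun m → Bool) → PFun (N + m) → Bool
  (d₁ ⊕ d₂) σ = (isEmpty (drop N σ) ∧ d₁ (take N σ)) ∨ (isEmpty (take N σ) ∧ d₂ (drop N σ))

  module _ {d₁ : PFun N → Bool} {d₂ : PFun m → Bool} where

    ⊕-padʳ : {a : PFun N} → T (d₁ a) → T ((d₁ ⊕ d₂) (padʳ a))
    ⊕-padʳ {a} d₁a rewrite take-++ a (∅ᵖ {m}) | drop-++ a (∅ᵖ {m}) =
      Equivalence.from (T-∨ {isEmpty (∅ᵖ {m}) ∧ d₁ a})
        (inj₁ (Equivalence.from (T-∧ {isEmpty (∅ᵖ {m})}) (isEmpty-∅ᵖ , d₁a)))

    ⊕-padˡ : {b : PFun m} → T (d₂ b) → T ((d₁ ⊕ d₂) (padˡ b))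
    ⊕-padˡ {b} d₂b rewrite take-++ (∅ᵖ {N}) b | drop-++ (∅ᵖ {N}) b =
      Equivalence.from (T-∨ {isEmpty b ∧ d₁ ∅ᵖ})
        (inj₂ (Equivalence.from (T-∧ {isEmpty (∅ᵖ {N})}) (isEmpty-∅ᵖ , d₂b)))

    ⊕-cases : (σ : PFun (N + m)) → T ((d₁ ⊕ d₂) σ) → Image padʳ ⟦ d₁ ⟧ σ ⊎ Image padˡ ⟦ d₂ ⟧ σ
    ⊕-cases σ d₁⊕d₂σ with Equivalence.to (T-∨ {isEmpty (drop N σ) ∧ d₁ (take N σ)}) d₁⊕d₂σ
    ... | inj₁ left with Equivalence.to (T-∧ {isEmpty (drop N σ)}) left
    ...   | rightEmpty , d₁a =
      inj₁ (take N σ , d₁a ,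
            trans (sym (take++drop≡id N σ)) (cong (take N σ ++_) (isEmpty⇒≡∅ᵖ (drop N σ) rightEmpty)))
    ⊕-cases σ d₁⊕d₂σ | inj₂ right with Equivalence.to (T-∧ {isEmpty (take N σ)}) right
    ...   | leftEmpty , d₂b =
      inj₂ (drop N σ , d₂b ,
            trans (sym (take++drop≡id N σ)) (cong (_++ drop N σ) (isEmpty⇒≡∅ᵖ (take N σ) leftEmpty)))

  padʳ-injective : {a a′ : PFun N} → padʳ a ≡ padʳ a′ → a ≡ a′
  padʳ-injective {a} {a′} = ++-injectiveˡ a a′

  padˡ-injective : {b b′ : PFun m} → padˡ b ≡ padˡ b′ → b ≡ b′
  padˡ-injective = ++-injectiveʳ ∅ᵖ ∅ᵖ

  padʳ≡padˡ⇒∅ᵖ : {a : PFun N} {b : PFun m} → padʳ a ≡ padˡ b → a ≡ ∅ᵖ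
  padʳ≡padˡ⇒∅ᵖ {a} = ++-injectiveˡ a ∅ᵖ

  module _ (D₁ : List (PFun N)) (D₂ : List (PFun m)) where

    covered-pads-↑ˡ : (j : Fin N) → covered (map padʳ D₁ ++ₗ map padˡ D₂) (j ↑ˡ m) ≡ covered D₁ j
    covered-pads-↑ˡ j = begin
      covered (map padʳ D₁ ++ₗ map padˡ D₂) (j ↑ˡ m)
        ≡⟨ any-++-map (λ σ → is-just (lookup σ (j ↑ˡ m))) padʳ padˡ D₁ D₂ ⟩
      any (λ a → is-just (lookup (padʳ a) (j ↑ˡ m))) D₁ ∨
      any (λ b → is-just (lookup (padˡ b) (j ↑ˡ m))) D₂
        ≡⟨ cong₂ _∨_ (any-cong (λ a → cong is-just (lookup-++ˡ a ∅ᵖ j)) D₁)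
                     (any-false _ (All.universal (λ b →
                       cong is-just (trans (lookup-++ˡ ∅ᵖ b j) (lookup-replicate j nothing))) D₂)) ⟩
      covered D₁ j ∨ false
        ≡⟨ ∨-identityʳ _ ⟩
      covered D₁ j ∎
      where open ≡-Reasoning

    covered-pads-↑ʳ : (j : Fin m) → covered (map padʳ D₁ ++ₗ map padˡ D₂) (N ↑ʳ j) ≡ covered D₂ j
    covered-pads-↑ʳ j = begin
      covered (map padʳ D₁ ++ₗ map padˡ D₂) (N ↑ʳ j)
        ≡⟨ any-++-map (λ σ → is-just (lookup σ (N ↑ʳ j))) padʳ padˡ D₁ D₂ ⟩
      any (λ a → is-just (lookup (padʳ a) (N ↑ʳ j))) D₁ ∨
      any (λ b → is-just (lookup (padˡ b) (N ↑ʳ j))) D₂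
        ≡⟨ cong₂ _∨_ (any-false _ (All.universal (λ a →
                       cong is-just (trans (lookup-++ʳ a ∅ᵖ j) (lookup-replicate j nothing))) D₁))
                     (any-cong (λ b → cong is-just (lookup-++ʳ (∅ᵖ {N}) b j)) D₂) ⟩
      covered D₂ j ∎
      where open ≡-Reasoning

    unionDomSize-pads :
      unionDomSize (map padʳ D₁ ++ₗ map padˡ D₂) ≡ unionDomSize D₁ + unionDomSize D₂
    unionDomSize-pads = trans (countᶠ-+ {N = N} (covered (map padʳ D₁ ++ₗ map padˡ D₂)))
      (cong₂ _+_ (countᶠ-cong covered-pads-↑ˡ) (countᶠ-cong covered-pads-↑ʳ))

    AllPairs-DisjointDom-pads : AllPairs DisjointDom D₁ → AllPairs DisjointDom D₂ →
      AllPairs DisjointDom (map padʳ D₁ ++ₗ map padˡ D₂)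
    AllPairs-DisjointDom-pads D₁# D₂# = AllPairs.++⁺
      (AllPairs.map⁺ (AllPairs.map (λ {a} {a′} a#a′ →
        DisjointDom-++ {a = a} {a′} {∅ᵖ} {∅ᵖ} a#a′ (∅ᵖ-disjointˡ ∅ᵖ)) D₁#))
      (AllPairs.map⁺ (AllPairs.map (λ {b} {b′} b#b′ →
        DisjointDom-++ {a = ∅ᵖ} {∅ᵖ} {b} {b′} (∅ᵖ-disjointˡ ∅ᵖ) b#b′) D₂#))
      (All.map⁺ (All.universal (λ a → All.map⁺ (All.universal (λ b →
        DisjointDom-++ {a = a} {∅ᵖ} {∅ᵖ} {b} (∅ᵖ-disjointʳ a) (∅ᵖ-disjointˡ b)) D₂)) D₁))

    Unique-pads : Unique D₁ → Unique D₂ → ¬ (∅ᵖ ∈ D₁) → Unique (map padʳ D₁ ++ₗ map padˡ D₂)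
    Unique-pads D₁! D₂! ∅ᵖ∉D₁ =
      Unique.++⁺ (Unique.map⁺ padʳ-injective D₁!) (Unique.map⁺ padˡ-injective D₂!) disjoint
      where
      disjoint : ∀ {σ} → ¬ (σ ∈ map padʳ D₁ × σ ∈ map padˡ D₂)
      disjoint (σ∈pads₁ , σ∈pads₂) with ∈-map⁻ padʳ σ∈pads₁ | ∈-map⁻ padˡ σ∈pads₂
      ... | a , a∈D₁ , refl | b , _ , padʳa≡padˡb =
        ∅ᵖ∉D₁ (subst (_∈ D₁) (padʳ≡padˡ⇒∅ᵖ padʳa≡padˡb) a∈D₁)

  HnProp-⊕ : {d₁ : PFun N → Bool} {d₂ : PFun m → Bool} {k₁ k₂ : ℕ} → 1 ≤ k₁ →
    HnProp ⟦ d₁ ⟧ k₁ → HnProp ⟦ d₂ ⟧ k₂ → HnProp ⟦ d₁ ⊕ d₂ ⟧ (k₁ ⊓ k₂)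
  HnProp-⊕ {d₁} {d₂} {k₁} {k₂} 1≤k₁ hn₁ hn₂ ys ys! ys⊆d₁⊕d₂
    with partitionImages padʳ padˡ (All.map (λ {σ} → ⊕-cases {d₁ = d₁} {d₂} σ) ys⊆d₁⊕d₂)
  ... | as , bs , as⊆d₁ , bs⊆d₂ , ys↭ with Unique-++⁻ (map padʳ as) (Unique-resp-↭ ys↭ ys!)
  ... | padsʳ! , padsˡ! with hn₁ as (Unique.map⁻ padsʳ!) as⊆d₁ | hn₂ bs (Unique.map⁻ padsˡ!) bs⊆d₂
  ... | D₁ , D₁! , D₁⊆as , D₁# , k₁|as|≤ | D₂ , D₂! , D₂⊆bs , D₂# , k₂|bs|≤ =
    map padʳ D₁ ++ₗ map padˡ D₂ ,
    Unique-pads D₁ D₂ D₁! D₂! ∅ᵖ∉D₁ ,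
    All.tabulate (Subset.⊆-reflexive-↭ (↭-sym ys↭) ∘
      Subset.++⁺ (Subset.map⁺ padʳ (All.lookup D₁⊆as)) (Subset.map⁺ padˡ (All.lookup D₂⊆bs))) ,
    AllPairs-DisjointDom-pads D₁ D₂ D₁# D₂# ,
    bound
    where
    ∅ᵖ∉D₁ : ¬ (∅ᵖ ∈ D₁)
    ∅ᵖ∉D₁ ∅ᵖ∈D₁ = HnProp⇒∅ᵖ∉ 1≤k₁ hn₁ (All.lookup as⊆d₁ (All.lookup D₁⊆as ∅ᵖ∈D₁))

    |ys|≡|as|+|bs| : length ys ≡ length as + length bs
    |ys|≡|as|+|bs| = trans (↭-length ys↭)
      (trans (length-++ (map padʳ as)) (cong₂ _+_ (length-map padʳ as) (length-map padˡ bs)))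

    open ≤-Reasoning
    bound : (k₁ ⊓ k₂) * length ys ≤ unionDomSize (map padʳ D₁ ++ₗ map padˡ D₂)
    bound = begin
      (k₁ ⊓ k₂) * length ys
        ≡⟨ cong ((k₁ ⊓ k₂) *_) |ys|≡|as|+|bs| ⟩
      (k₁ ⊓ k₂) * (length as + length bs)
        ≡⟨ *-distribˡ-+ (k₁ ⊓ k₂) (length as) (length bs) ⟩
      (k₁ ⊓ k₂) * length as + (k₁ ⊓ k₂) * length bs
        ≤⟨ +-mono-≤ (*-monoˡ-≤ (length as) (m⊓n≤m k₁ k₂)) (*-monoˡ-≤ (length bs) (m⊓n≤n k₁ k₂)) ⟩
      k₁ * length as + k₂ * length bs
        ≤⟨ +-mono-≤ k₁|as|≤ k₂|bs|≤ ⟩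
      unionDomSize D₁ + unionDomSize D₂
        ≡⟨ sym (unionDomSize-pads D₁ D₂) ⟩
      unionDomSize (map padʳ D₁ ++ₗ map padˡ D₂) ∎

module ProductSet {N m : ℕ} {A₁ : Fun N → Bool} {A₂ : Fun m → Bool} {A : Fun (N + m) → Bool}
  (A≡A₁×A₂ : ∀ h → T (A h) ⇔ (∃₂ λ f g → T (A₁ f) × T (A₂ g) × h ≡ f ++ g)) where

  open Juxtaposition N m

  Meets-++⁺ : {a : PFun N} {b : PFun m} → Meets a A₁ → Meets b A₂ → Meets (a ++ b) A
  Meets-++⁺ {a} {b} (f , a⊆f , A₁f) (g , b⊆g , A₂g) =
    f ++ g , ⊆ᶠ-++ {a = a} {b} {f} {g} a⊆f b⊆g ,
    Equivalence.from (A≡A₁×A₂ (f ++ g)) (f , g , A₁f , A₂g , refl)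

  Meets-++⁻ : (a : PFun N) {b : PFun m} → Meets (a ++ b) A → Meets a A₁ × Meets b A₂
  Meets-++⁻ a {b} (h , a++b⊆h , Ah) with Equivalence.to (A≡A₁×A₂ h) Ah
  ... | f , g , A₁f , A₂g , refl with ⊆ᶠ-++⁻ a f {b} {g} a++b⊆h
  ...   | a⊆f , b⊆g = (f , a⊆f , A₁f) , (g , b⊆g , A₂g)

  Δ-++⁻ˡ : (a : PFun N) {b : PFun m} → Meets b A₂ → Δ A (a ++ b) → Δ A₁ a
  Δ-++⁻ˡ a {b} b∩A₂ (a++b∩A≡∅ , minimal) =
    (λ a∩A₁ → a++b∩A≡∅ (Meets-++⁺ {a} {b} a∩A₁ b∩A₂)) ,
    (λ ρ ρ⊊a → proj₁ (Meets-++⁻ ρ (minimal (ρ ++ b) (⊊ᵖ-++ˡ {ρ = ρ} {a} b ρ⊊a))))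

  Δ-++⁻ʳ : (a : PFun N) {b : PFun m} → Meets a A₁ → Δ A (a ++ b) → Δ A₂ b
  Δ-++⁻ʳ a {b} a∩A₁ (a++b∩A≡∅ , minimal) =
    (λ b∩A₂ → a++b∩A≡∅ (Meets-++⁺ {a} {b} a∩A₁ b∩A₂)) ,
    (λ ρ ρ⊊b → proj₂ (Meets-++⁻ a (minimal (a ++ ρ) (⊊ᵖ-++ʳ a {ρ} {b} ρ⊊b))))

  -- If b ≠ ∅ then a ∪ ∅ ⊊ a ∪ b meets A, so a meets A₁.
  Δ-++⁻ : (∃ λ g → T (A₂ g)) → (a : PFun N) (b : PFun m) → Δ A (a ++ b) → Δ A₁ a ⊎ Δ A₂ b
  Δ-++⁻ (g , A₂g) a b Δab with b ≟ᵖ ∅ᵖ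
  ... | yes refl = inj₁ (Δ-++⁻ˡ a (g , ∅ᵖ-⊆ᶠ g , A₂g) Δab)
  ... | no b≢∅ = inj₂ (Δ-++⁻ʳ a a∩A₁ Δab)
    where
    a∩A₁ : Meets a A₁
    a∩A₁ = proj₁ (Meets-++⁻ a (proj₂ Δab (a ++ ∅ᵖ) (⊊ᵖ-++ʳ a {∅ᵖ} {b} (∅ᵖ-⊆ᵖ b , b≢∅ ∘ sym))))

  ⪯-⊕ : (∃ λ g → T (A₂ g)) → {d₁ : PFun N → Bool} {d₂ : PFun m → Bool} →
    Δ A₁ ⪯ ⟦ d₁ ⟧ → Δ A₂ ⪯ ⟦ d₂ ⟧ → Δ A ⪯ ⟦ d₁ ⊕ d₂ ⟧
  ⪯-⊕ A₂≢∅ {d₁} {d₂} Δ₁⪯d₁ Δ₂⪯d₂ σ Δσ with splitAt N σ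
  ... | a , b , refl with Δ-++⁻ A₂≢∅ a b Δσ
  ...   | inj₁ Δa = let ρ , d₁ρ , ρ⊆a = Δ₁⪯d₁ a Δa in
    padʳ ρ , ⊕-padʳ {d₁ = d₁} {d₂} d₁ρ , ⊆ᵖ-++ {a = ρ} {a} {∅ᵖ} {b} ρ⊆a (∅ᵖ-⊆ᵖ b)
  ...   | inj₂ Δb = let ρ , d₂ρ , ρ⊆b = Δ₂⪯d₂ b Δb in
    padˡ ρ , ⊕-padˡ {d₁ = d₁} {d₂} d₂ρ , ⊆ᵖ-++ {a = ∅ᵖ} {a} {ρ} {b} (∅ᵖ-⊆ᵖ a) ρ⊆b

-- The maximum defining hn(d) is not computable, but k < v is decidable, so it suffices
-- that the maximum exists up to double negation.
HnProp⇒<HN : {δ : Pred (PFun n) 0ℓ} {v : ℕ} {d : PFun n → Bool} {k : ℕ} →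
  IsHN δ v → δ ⪯ ⟦ d ⟧ → k < n → HnProp ⟦ d ⟧ k → k < v
HnProp⇒<HN {n = n} {v = v} {d} {k} (_ , HN-maximal) δ⪯d k<n hnₖ =
  decidable-stable (k <? v) λ k≮v →
    ¬¬-maximum {P} (λ _ → proj₁) (k<n , hnₖ) λ (j , Pj , j-maximal) →
      k≮v (≤-trans (s≤s (j-maximal k (k<n , hnₖ)))
                   (HN-maximal (suc j) (d , δ⪯d , isHn j Pj j-maximal)))
  where
  P : ℕ → Set
  P j = j < n × HnProp ⟦ d ⟧ j

  isHn : ∀ j → P j → (∀ j′ → P j′ → j′ ≤ j) → IsHn ⟦ d ⟧ (suc j)
  isHn j (j<n , hnⱼ) j-maximal =
    (j , j<n , refl , hnⱼ) , λ { _ (j′ , j′<n , refl , hnⱼ′) → s≤s (j-maximal j′ (j′<n , hnⱼ′)) }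

mainTheorem16 : (N m : ℕ) → 0 < m →
    (A₁ : Fun N → Bool) (A₂ : Fun m → Bool) (A : Fun (N + m) → Bool) →
    (∃ λ f → T (A₁ f)) → (∃ λ g → T (A₂ g)) →
    (∀ h → T (A h) ⇔ (∃₂ λ f g → T (A₁ f) × T (A₂ g) × h ≡ f ++ g)) →
    (v₁ v₂ v : ℕ) → IsNorm4 A₁ v₁ → IsNorm4 A₂ v₂ → IsNorm4 A v →
    1 < v₁ → 1 < v₂ → v₁ ⊓ v₂ ≤ v
mainTheorem16 N m _ A₁ A₂ A _ A₂≢∅ A≡A₁×A₂ _ _ v
  ((d₁ , Δ₁⪯d₁ , (k₁ , _ , refl , hn₁) , _) , _)
  ((d₂ , Δ₂⪯d₂ , (k₂ , k₂<m , refl , hn₂) , _) , _)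
  ‖A‖≡v (s≤s 1≤k₁) _ =
  HnProp⇒<HN ‖A‖≡v (⪯-⊕ A₂≢∅ Δ₁⪯d₁ Δ₂⪯d₂) k₁⊓k₂<N+m (HnProp-⊕ 1≤k₁ hn₁ hn₂)
  where
  open Juxtaposition N m
  open ProductSet A≡A₁×A₂

  k₁⊓k₂<N+m : k₁ ⊓ k₂ < N + m
  k₁⊓k₂<N+m = ≤-trans (s≤s (m⊓n≤n k₁ k₂)) (≤-trans k₂<m (m≤n+m m N))
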